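{- Let $\mathsf{T}=(t_{n,k})_{n,k\ge0}$ with $t_{n,k}=\binom nk n^{n-k}$ (with $0^0=1$). The production matrix $P=\mathsf{T}^{ -1}\Delta\mathsf{T}=(p_{n,k})_{n,k\ge0}$ is unit-lower-Hessenberg (so $p_{n,k}=0$ for $k>n+1$) with entries, for $0\le k\le n+1$, $$p_{n,k}=n\binom{n}{k}S_{n-k}+\binom{n+1}{k}=\frac{n!}{k!\,(n-k+1)!}\,\big(nS_{n-k+1}+1\big),$$ where $S_m=\sum_{j=0}^m m!/j!$ (and the term $n\binom nk S_{n-k}$ is $0$ when $k=n+1$). In particular $p_{n,0}=p_{n,1}=nS_n+1$ for all $n\ge0$.
   Context: $\Delta=(\delta_{i+1,j})_{i,j\ge0}$ is the matrix with $1$ on the superdiagonal and $0$ elsewhere. -}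

module Defs where

open import Data.Nat using (ℕ; zero; suc; _+_; _*_; _∸_; _^_; _≤_; _<_; _!)
open import Data.Nat.Properties using (_!≢0)
open import Data.Nat.DivMod using (_/_)
open import Data.Nat.Combinatorics using (_C_)
open import Data.Integer as ℤ using (ℤ; +_)
open import Data.Product using (_×_)
open import Relation.Binary.PropositionalEquality using (_≡_)

sumTo : ℕ → (ℕ → ℤ) → ℤ
sumTo zero    f = + 0
sumTo (suc n) f = sumTo n f ℤ.+ f n

sumℕ : ℕ → (ℕ → ℕ) → ℕ
sumℕ zero    f = 0
sumℕ (suc n) f = sumℕ n f + f n

-- Infinite matrices indexed by ℕ × ℕ (row, column), integer entries.
Mat : Set
Mat = ℕ → ℕ → ℤ

δ : ℕ → ℕ → ℤ
δ zero    zero    = + 1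
δ zero    (suc k) = + 0
δ (suc n) zero    = + 0
δ (suc n) (suc k) = δ n k

LowerTriangular : Mat → Set
LowerTriangular A = ∀ n k → n < k → A n k ≡ + 0

Δ : Mat
Δ i j = δ (suc i) j

-- T = (t_{n,k}), t_{n,k} = C(n,k) n^(n-k)   (Agda: 0 ^ 0 = 1; C(n,k) = 0 for k > n)
t : ℕ → ℕ → ℕ
t n k = (n C k) * n ^ (n ∸ k)

T : Mat
T n k = + t n k

-- Product A·B of infinite matrices where A is lower triangular
-- (so row n of A is supported on columns 0..n and the sum is finite).
_·ₗ_ : Mat → Mat → Mat
(A ·ₗ B) n k = sumTo (suc n) (λ i → A n i ℤ.* B i k)

-- Δ·T : row i of Δ is supported on column i+1, so the sum over j ≤ i+1 is the full product.
ΔT : Mat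
ΔT i k = sumTo (suc (suc i)) (λ j → Δ i j ℤ.* T j k)

IsInverseOfT : Mat → Set
IsInverseOfT U = LowerTriangular U × (∀ n k → (U ·ₗ T) n k ≡ δ n k) × (∀ n k → (T ·ₗ U) n k ≡ δ n k)

prod : Mat → Mat
prod U = U ·ₗ ΔT

S : ℕ → ℕ
S m = sumℕ (suc m) (λ j → _/_ (m !) (j !) {{j !≢0}})

{-# OPTIONS --safe #-}
module Submission where

-- Let p n k be the claimed entries. As U·T = I and T is lower triangular, P = U·(ΔT) follows from
-- ΔT = T·P, i.e. t(i+1,k) = Σ_j (i C j) i^(i-j) p(j,k). Such binomial sums obey a Pascal-type
-- recursion, under which j ↦ (j C k) h(j-k) is sent to (m C k) times the transform of h at m-k and the
-- constant 1 to (1+x)^m. Using S_l = l S_{l-1} + 1, the part j (j C k) S(j-k) of p(j,k) is sent to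
-- (i C k) i (1+i)^(i-k), which is exactly what the part (j+1 C k) needs to complete to t(i+1,k).

open import Defs
open import Data.Nat using (ℕ; zero; suc; _+_; _*_; _∸_; _^_; _≤_; _<_; _!; _≤?_; s≤s)
open import Data.Nat.Properties
open import Data.Nat.Combinatorics
  using (_C_; k>n⇒nCk≡0; nCn≡1; nC1≡n; nCk+nC[k+1]≡[n+1]C[k+1]; nCk≡n!/k![n-k]!; k![n∸k]!∣n!)
open import Data.Nat.DivMod using (_/_; m/n*n≡m; *-/-assoc; n/n≡1)
open import Data.Nat.Divisibility using (m≤n⇒m!∣n!)
open import Data.Nat.Tactic.RingSolver using (solve-∀)
open import Data.Integer as ℤ using (ℤ; +_)
import Data.Integer.Properties as ℤP
open import Data.Product using (_×_; _,_)
open import Data.Sum using (inj₁; inj₂)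
open import Function using (_∘_)
open import Relation.Binary.PropositionalEquality
open import Relation.Nullary using (yes; no; contradiction)
import Algebra.Properties.CommutativeSemigroup as CommSemigroupProperties

open ≡-Reasoning
open CommSemigroupProperties *-commutativeSemigroup using (x∙yz≈y∙xz)

sumℕ-cong : ∀ N {f g : ℕ → ℕ} → (∀ l → l < N → f l ≡ g l) → sumℕ N f ≡ sumℕ N g
sumℕ-cong zero    f≡g = refl
sumℕ-cong (suc N) f≡g = cong₂ _+_ (sumℕ-cong N (λ l l<N → f≡g l (m<n⇒m<1+n l<N))) (f≡g N (n<1+n N))

sumℕ-head : ∀ N (f : ℕ → ℕ) → sumℕ (suc N) f ≡ f 0 + sumℕ N (f ∘ suc)
sumℕ-head zero    f = sym (+-identityʳ (f 0))
sumℕ-head (suc N) f = trans (cong (_+ f (suc N)) (sumℕ-head N f)) (+-assoc (f 0) _ _)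

sumℕ-+ : ∀ N (f g : ℕ → ℕ) → sumℕ N (λ l → f l + g l) ≡ sumℕ N f + sumℕ N g
sumℕ-+ zero    f g = refl
sumℕ-+ (suc N) f g = trans (cong (_+ (f N + g N)) (sumℕ-+ N f g))
                           (interchange (sumℕ N f) (sumℕ N g) (f N) (g N))
  where open CommSemigroupProperties +-commutativeSemigroup using (interchange)

sumℕ-*ˡ : ∀ N c (f : ℕ → ℕ) → sumℕ N (λ l → c * f l) ≡ c * sumℕ N f
sumℕ-*ˡ zero    c f = sym (*-zeroʳ c)
sumℕ-*ˡ (suc N) c f = trans (cong (_+ c * f N) (sumℕ-*ˡ N c f)) (sym (*-distribˡ-+ c (sumℕ N f) (f N)))

nCk*-cong : ∀ n k {a b} → (k ≤ n → a ≡ b) → (n C k) * a ≡ (n C k) * b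
nCk*-cong n k a≡b with k ≤? n
... | yes k≤n = cong ((n C k) *_) (a≡b k≤n)
... | no  k≰n rewrite k>n⇒nCk≡0 (≰⇒> k≰n) = refl

nCk*k!*[n∸k]!≡n! : ∀ {n k} → k ≤ n → (n C k) * (k ! * (n ∸ k) !) ≡ n !
nCk*k!*[n∸k]!≡n! {n} {k} k≤n = begin
  (n C k) * (k ! * (n ∸ k) !)                 ≡⟨ cong (_* (k ! * (n ∸ k) !)) (nCk≡n!/k![n-k]! k≤n) ⟩
  n ! / (k ! * (n ∸ k) !) * (k ! * (n ∸ k) !) ≡⟨ m/n*n≡m (k![n∸k]!∣n! k≤n) ⟩
  n !                                         ∎
  where instance _ = k !* (n ∸ k) !≢0

-- Bin x f m = Σ_{l ≤ m} (m C l) x^(m-l) f l (binomialSum≡Bin), i.e. ((x + shift)^m f) 0.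
Bin : ℕ → (ℕ → ℕ) → ℕ → ℕ
Bin x f zero    = f 0
Bin x f (suc m) = x * Bin x f m + Bin x (f ∘ suc) m

Bin-cong : ∀ x {f g : ℕ → ℕ} → (∀ l → f l ≡ g l) → ∀ m → Bin x f m ≡ Bin x g m
Bin-cong x f≡g zero    = f≡g 0
Bin-cong x f≡g (suc m) = cong₂ (λ a b → x * a + b) (Bin-cong x f≡g m) (Bin-cong x (f≡g ∘ suc) m)

Bin-+ : ∀ x (f g : ℕ → ℕ) m → Bin x (λ l → f l + g l) m ≡ Bin x f m + Bin x g m
Bin-+ x f g zero    = refl
Bin-+ x f g (suc m) = begin
  x * Bin x (λ l → f l + g l) m + Bin x (λ l → f (suc l) + g (suc l)) m
    ≡⟨ cong₂ (λ a b → x * a + b) (Bin-+ x f g m) (Bin-+ x (f ∘ suc) (g ∘ suc) m) ⟩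
  x * (Bin x f m + Bin x g m) + (Bin x (f ∘ suc) m + Bin x (g ∘ suc) m)
    ≡⟨ regroup x (Bin x f m) (Bin x g m) (Bin x (f ∘ suc) m) (Bin x (g ∘ suc) m) ⟩
  (x * Bin x f m + Bin x (f ∘ suc) m) + (x * Bin x g m + Bin x (g ∘ suc) m) ∎
  where
  regroup : ∀ x a b c d → x * (a + b) + (c + d) ≡ (x * a + c) + (x * b + d)
  regroup = solve-∀

Bin-*ˡ : ∀ x c (f : ℕ → ℕ) m → Bin x (λ l → c * f l) m ≡ c * Bin x f m
Bin-*ˡ x c f zero    = refl
Bin-*ˡ x c f (suc m) = begin
  x * Bin x (λ l → c * f l) m + Bin x (λ l → c * f (suc l)) m
    ≡⟨ cong₂ (λ a b → x * a + b) (Bin-*ˡ x c f m) (Bin-*ˡ x c (f ∘ suc) m) ⟩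
  x * (c * Bin x f m) + c * Bin x (f ∘ suc) m
    ≡⟨ factor x c (Bin x f m) (Bin x (f ∘ suc) m) ⟩
  c * (x * Bin x f m + Bin x (f ∘ suc) m) ∎
  where
  factor : ∀ x c a b → x * (c * a) + c * b ≡ c * (x * a + b)
  factor = solve-∀

Bin-one : ∀ x m → Bin x (λ _ → 1) m ≡ suc x ^ m
Bin-one x zero    = refl
Bin-one x (suc m) = trans (cong (λ a → x * a + a) (Bin-one x m)) (+-comm (x * suc x ^ m) _)

binomShift : ℕ → (ℕ → ℕ) → ℕ → ℕ
binomShift k h j = (j C k) * h (j ∸ k)

binomShift-pascal : ∀ k h j →
  binomShift (suc k) h (suc j) ≡ binomShift k h j + binomShift (suc k) (h ∘ suc) j
binomShift-pascal k h j = begin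
  (suc j C suc k) * h (j ∸ k)
    ≡⟨ cong (_* h (j ∸ k)) (nCk+nC[k+1]≡[n+1]C[k+1] j k) ⟨
  ((j C k) + (j C suc k)) * h (j ∸ k)
    ≡⟨ *-distribʳ-+ (h (j ∸ k)) (j C k) (j C suc k) ⟩
  (j C k) * h (j ∸ k) + (j C suc k) * h (j ∸ k)
    ≡⟨ cong (_+_ ((j C k) * h (j ∸ k))) (nCk*-cong j (suc k) (cong h ∘ +-∸-assoc 1)) ⟩
  (j C k) * h (j ∸ k) + (j C suc k) * h (suc (j ∸ suc k)) ∎

Bin-binomShift : ∀ x k h m → Bin x (binomShift k h) m ≡ (m C k) * Bin x h (m ∸ k)
Bin-binomShift x zero    h m       = Bin-*ˡ x 1 h m
Bin-binomShift x (suc k) h zero    = refl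
Bin-binomShift x (suc k) h (suc m) = begin
  x * Bin x (binomShift (suc k) h) m + Bin x (binomShift (suc k) h ∘ suc) m
    ≡⟨ cong (_+_ (x * Bin x (binomShift (suc k) h) m))
         (trans (Bin-cong x (binomShift-pascal k h) m) (Bin-+ x _ _ m)) ⟩
  x * Bin x (binomShift (suc k) h) m + (Bin x (binomShift k h) m + Bin x (binomShift (suc k) (h ∘ suc)) m)
    ≡⟨ cong₂ (λ a b → x * a + b) (Bin-binomShift x (suc k) h m)
         (cong₂ _+_ (Bin-binomShift x k h m) (Bin-binomShift x (suc k) (h ∘ suc) m)) ⟩
  x * ((m C suc k) * Bin x h (m ∸ suc k)) + ((m C k) * Bin x h (m ∸ k) + (m C suc k) * Bin x (h ∘ suc) (m ∸ suc k))
    ≡⟨ regroup x (m C k) (m C suc k) (Bin x h (m ∸ k)) (Bin x h (m ∸ suc k)) (Bin x (h ∘ suc) (m ∸ suc k)) ⟩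
  (m C k) * Bin x h (m ∸ k) + (m C suc k) * Bin x h (suc (m ∸ suc k))
    ≡⟨ cong (_+_ ((m C k) * Bin x h (m ∸ k))) (nCk*-cong m (suc k) (cong (Bin x h) ∘ +-∸-assoc 1)) ⟨
  (m C k) * Bin x h (m ∸ k) + (m C suc k) * Bin x h (m ∸ k)
    ≡⟨ *-distribʳ-+ (Bin x h (m ∸ k)) (m C k) (m C suc k) ⟨
  ((m C k) + (m C suc k)) * Bin x h (m ∸ k)
    ≡⟨ cong (_* Bin x h (m ∸ k)) (nCk+nC[k+1]≡[n+1]C[k+1] m k) ⟩
  (suc m C suc k) * Bin x h (m ∸ k) ∎
  where
  regroup : ∀ x a b u v w → x * (b * v) + (a * u + b * w) ≡ a * u + b * (x * v + w)
  regroup = solve-∀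

Bin-choose : ∀ x k m → Bin x (_C k) m ≡ (m C k) * suc x ^ (m ∸ k)
Bin-choose x k m = begin
  Bin x (_C k) m                    ≡⟨ Bin-cong x (λ j → sym (*-identityʳ (j C k))) m ⟩
  Bin x (binomShift k (λ _ → 1)) m  ≡⟨ Bin-binomShift x k _ m ⟩
  (m C k) * Bin x (λ _ → 1) (m ∸ k) ≡⟨ cong ((m C k) *_) (Bin-one x (m ∸ k)) ⟩
  (m C k) * suc x ^ (m ∸ k)         ∎

Bin-index : ∀ x g m → Bin x (λ l → l * g (l ∸ 1)) (suc m) ≡ suc m * Bin x g m
Bin-index x g m = begin
  Bin x (λ l → l * g (l ∸ 1)) (suc m) ≡⟨ Bin-cong x (λ l → cong (_* g (l ∸ 1)) (sym (nC1≡n l))) (suc m) ⟩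
  Bin x (binomShift 1 g) (suc m)      ≡⟨ Bin-binomShift x 1 g (suc m) ⟩
  (suc m C 1) * Bin x g m             ≡⟨ cong (_* Bin x g m) (nC1≡n (suc m)) ⟩
  suc m * Bin x g m                   ∎

binomialSum : ℕ → (ℕ → ℕ) → ℕ → ℕ
binomialSum x f m = sumℕ (suc m) (λ l → (m C l) * x ^ (m ∸ l) * f l)

binomialSum≡Bin : ∀ x f m → binomialSum x f m ≡ Bin x f m
binomialSum≡Bin x f zero    = +-identityʳ (f 0)
binomialSum≡Bin x f (suc m) = begin
  sumℕ (suc (suc m)) g′
    ≡⟨ sumℕ-head (suc m) g′ ⟩
  g′ 0 + sumℕ (suc m) (g′ ∘ suc)
    ≡⟨ cong (_+_ (g′ 0)) (trans (sumℕ-cong (suc m) (λ l _ → g′-suc l)) (sumℕ-+ (suc m) _ _)) ⟩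
  g′ 0 + (binomialSum x (f ∘ suc) m + sumℕ (suc m) (λ l → x * g (suc l)))
    ≡⟨ cong (λ s → g′ 0 + (binomialSum x (f ∘ suc) m + s)) (sumℕ-*ˡ (suc m) x (g ∘ suc)) ⟩
  g′ 0 + (binomialSum x (f ∘ suc) m + x * sumℕ (suc m) (g ∘ suc))
    ≡⟨ factor-x x (x ^ m) (f 0) (binomialSum x (f ∘ suc) m) (sumℕ (suc m) (g ∘ suc)) ⟩
  x * (g 0 + sumℕ (suc m) (g ∘ suc)) + binomialSum x (f ∘ suc) m
    ≡⟨ cong (λ s → x * s + binomialSum x (f ∘ suc) m) (sumℕ-head (suc m) g) ⟨
  x * (sumℕ (suc m) g + g (suc m)) + binomialSum x (f ∘ suc) m
    ≡⟨ cong (λ s → x * s + binomialSum x (f ∘ suc) m) last-vanishes ⟩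
  x * binomialSum x f m + binomialSum x (f ∘ suc) m
    ≡⟨ cong₂ (λ a b → x * a + b) (binomialSum≡Bin x f m) (binomialSum≡Bin x (f ∘ suc) m) ⟩
  x * Bin x f m + Bin x (f ∘ suc) m ∎
  where
  g g′ : ℕ → ℕ
  g  l = (m C l) * x ^ (m ∸ l) * f l
  g′ l = (suc m C l) * x ^ (suc m ∸ l) * f l
  factor-x : ∀ x p z b s → 1 * (x * p) * z + (b + x * s) ≡ x * (1 * p * z + s) + b
  factor-x = solve-∀
  rearrange : ∀ x c p z → c * (x * p) * z ≡ x * (c * p * z)
  rearrange = solve-∀
  g′-suc : ∀ l → g′ (suc l) ≡ (m C l) * x ^ (m ∸ l) * f (suc l) + x * g (suc l)
  g′-suc l = begin
    (suc m C suc l) * x ^ (m ∸ l) * f (suc l)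
      ≡⟨ cong (λ c → c * x ^ (m ∸ l) * f (suc l)) (nCk+nC[k+1]≡[n+1]C[k+1] m l) ⟨
    ((m C l) + (m C suc l)) * x ^ (m ∸ l) * f (suc l)
      ≡⟨ cong (_* f (suc l)) (*-distribʳ-+ (x ^ (m ∸ l)) (m C l) (m C suc l)) ⟩
    ((m C l) * x ^ (m ∸ l) + (m C suc l) * x ^ (m ∸ l)) * f (suc l)
      ≡⟨ *-distribʳ-+ (f (suc l)) ((m C l) * x ^ (m ∸ l)) _ ⟩
    (m C l) * x ^ (m ∸ l) * f (suc l) + (m C suc l) * x ^ (m ∸ l) * f (suc l)
      ≡⟨ cong (λ e → (m C l) * x ^ (m ∸ l) * f (suc l) + e * f (suc l))
           (nCk*-cong m (suc l) (cong (x ^_) ∘ +-∸-assoc 1)) ⟩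
    (m C l) * x ^ (m ∸ l) * f (suc l) + (m C suc l) * (x * x ^ (m ∸ suc l)) * f (suc l)
      ≡⟨ cong (_+_ ((m C l) * x ^ (m ∸ l) * f (suc l))) (rearrange x (m C suc l) _ (f (suc l))) ⟩
    (m C l) * x ^ (m ∸ l) * f (suc l) + x * g (suc l) ∎
  last-vanishes : sumℕ (suc m) g + g (suc m) ≡ binomialSum x f m
  last-vanishes rewrite k>n⇒nCk≡0 (n<1+n m) = +-identityʳ _

S-suc : ∀ m → S (suc m) ≡ suc m * S m + 1
S-suc m = cong₂ _+_ earlier-terms (n/n≡1 (suc m !) {{suc m !≢0}})
  where
  earlier-terms : sumℕ (suc m) (λ j → _/_ (suc m !) (j !) {{j !≢0}}) ≡ suc m * S m
  earlier-terms = trans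
    (sumℕ-cong (suc m) (λ j j≤m → *-/-assoc (suc m) {{j !≢0}} (m≤n⇒m!∣n! (≤-pred j≤m))))
    (sumℕ-*ˡ (suc m) (suc m) (λ j → _/_ (m !) (j !) {{j !≢0}}))

Bin-S-suc : ∀ x m → Bin x S (suc m) ≡ suc m * Bin x S m + suc x ^ suc m
Bin-S-suc x m = begin
  Bin x S (suc m)                                                  ≡⟨ Bin-cong x S≡l*S[l∸1]+1 (suc m) ⟩
  Bin x (λ l → l * S (l ∸ 1) + 1) (suc m)                          ≡⟨ Bin-+ x _ _ (suc m) ⟩
  Bin x (λ l → l * S (l ∸ 1)) (suc m) + Bin x (λ _ → 1) (suc m)    ≡⟨ cong₂ _+_ (Bin-index x S m) (Bin-one x (suc m)) ⟩
  suc m * Bin x S m + suc x ^ suc m                                ∎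
  where
  S≡l*S[l∸1]+1 : ∀ l → S l ≡ l * S (l ∸ 1) + 1
  S≡l*S[l∸1]+1 zero    = refl
  S≡l*S[l∸1]+1 (suc l) = S-suc l

Bin-l*S : ∀ x m → Bin x (λ l → l * S l) (suc m) ≡ suc m * Bin x (S ∘ suc) m
Bin-l*S x m = trans (Bin-cong x l*S≡l*S[1+[l∸1]] (suc m)) (Bin-index x (S ∘ suc) m)
  where
  l*S≡l*S[1+[l∸1]] : ∀ l → l * S l ≡ l * S (suc (l ∸ 1))
  l*S≡l*S[1+[l∸1]] zero    = refl
  l*S≡l*S[1+[l∸1]] (suc l) = refl

-- Writing A m = Bin x S m, the recursion of Bin gives A (m+1) = x A m + Bin x (S ∘ suc) m, while
-- Bin-S-suc gives A (m+1) = (m+1) A m + (1+x)^(m+1); with x = k + m + 1 the two combine to the claim.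
Bin-[k+l]*S : ∀ k m → Bin (k + m) (λ l → (k + l) * S l) m ≡ (k + m) * suc (k + m) ^ m
Bin-[k+l]*S k zero    = refl
Bin-[k+l]*S k (suc m) = begin
  Bin x (λ l → (k + l) * S l) (suc m)
    ≡⟨ Bin-cong x (λ l → *-distribʳ-+ (S l) k l) (suc m) ⟩
  Bin x (λ l → k * S l + l * S l) (suc m)
    ≡⟨ Bin-+ x _ _ (suc m) ⟩
  Bin x (λ l → k * S l) (suc m) + Bin x (λ l → l * S l) (suc m)
    ≡⟨ cong₂ _+_ (Bin-*ˡ x k S (suc m)) (Bin-l*S x m) ⟩
  k * (x * a + c) + suc m * c
    ≡⟨ factor k (suc m) a c ⟩
  x * (k * a + c)
    ≡⟨ cong (x *_) ka+c≡y ⟩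
  x * y ∎
  where
  x = k + suc m
  a = Bin x S m
  c = Bin x (S ∘ suc) m
  y = suc x ^ suc m
  factor : ∀ k M a c → k * ((k + M) * a + c) + M * c ≡ (k + M) * (k * a + c)
  factor = solve-∀
  regroup : ∀ k M a c → (k + M) * a + c ≡ M * a + (k * a + c)
  regroup = solve-∀
  ka+c≡y : k * a + c ≡ y
  ka+c≡y = +-cancelˡ-≡ (suc m * a) _ _ (trans (sym (regroup k (suc m) a c)) (Bin-S-suc x m))

p : ℕ → ℕ → ℕ
p n k = n * (n C k) * S (n ∸ k) + (suc n C k)

Bin-j*jCk*S : ∀ i k → Bin i (λ j → j * (j C k) * S (j ∸ k)) i ≡ (i C k) * (i * suc i ^ (i ∸ k))
Bin-j*jCk*S i k = begin
  Bin i (λ j → j * (j C k) * S (j ∸ k)) i ≡⟨ Bin-cong i as-binomShift i ⟩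
  Bin i (binomShift k h) i               ≡⟨ Bin-binomShift i k h i ⟩
  (i C k) * Bin i h (i ∸ k)              ≡⟨ nCk*-cong i k (λ k≤i →
                                              subst (λ x → Bin x h (i ∸ k) ≡ x * suc x ^ (i ∸ k))
                                                    (m+[n∸m]≡n k≤i) (Bin-[k+l]*S k (i ∸ k))) ⟩
  (i C k) * (i * suc i ^ (i ∸ k))        ∎
  where
  h : ℕ → ℕ
  h l = (k + l) * S l
  as-binomShift : ∀ j → j * (j C k) * S (j ∸ k) ≡ binomShift k h j
  as-binomShift j = trans (trans (*-assoc j (j C k) (S (j ∸ k))) (x∙yz≈y∙xz j (j C k) (S (j ∸ k))))
    (nCk*-cong j k (λ k≤j → cong (_* S (j ∸ k)) (sym (m+[n∸m]≡n k≤j))))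

t-suc≡Σt*p : ∀ i k → t (suc i) k ≡ sumℕ (suc i) (λ j → t i j * p j k)
t-suc≡Σt*p i k = begin
  t (suc i) k
    ≡⟨ Bin-choose i k (suc i) ⟨
  i * Bin i (_C k) i + Bin i (λ j → suc j C k) i
    ≡⟨ cong (λ z → i * z + Bin i (λ j → suc j C k) i) (Bin-choose i k i) ⟩
  i * ((i C k) * suc i ^ (i ∸ k)) + Bin i (λ j → suc j C k) i
    ≡⟨ cong (_+ Bin i (λ j → suc j C k) i) (x∙yz≈y∙xz i (i C k) (suc i ^ (i ∸ k))) ⟩
  (i C k) * (i * suc i ^ (i ∸ k)) + Bin i (λ j → suc j C k) i
    ≡⟨ cong (_+ Bin i (λ j → suc j C k) i) (Bin-j*jCk*S i k) ⟨
  Bin i (λ j → j * (j C k) * S (j ∸ k)) i + Bin i (λ j → suc j C k) i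
    ≡⟨ Bin-+ i _ _ i ⟨
  Bin i (λ j → p j k) i
    ≡⟨ binomialSum≡Bin i (λ j → p j k) i ⟨
  sumℕ (suc i) (λ j → t i j * p j k) ∎

p-above-superdiagonal : ∀ n k → suc n < k → p n k ≡ 0
p-above-superdiagonal n k n+1<k
  rewrite k>n⇒nCk≡0 n+1<k | k>n⇒nCk≡0 (<-trans (n<1+n n) n+1<k) | *-zeroʳ n = refl

p-factorial : ∀ n k → k ≤ suc n → k ! * (suc n ∸ k) ! * p n k ≡ n ! * (n * S (suc n ∸ k) + 1)
p-factorial n k k≤n+1 with m≤n⇒m<n∨m≡n k≤n+1
... | inj₂ refl rewrite k>n⇒nCk≡0 (n<1+n n) | nCn≡1 (suc n) | n∸n≡0 n | *-zeroʳ n = simplify (n !) n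
  where
  simplify : ∀ f n → (f + n * f) * 1 * (0 + 1) ≡ f * (n * 1 + 1)
  simplify = solve-∀
... | inj₁ (s≤s k≤n) = begin
  k ! * (suc n ∸ k) ! * p n k
    ≡⟨ cong (λ r → k ! * r ! * p n k) n+1∸k≡1+m ⟩
  k ! * suc m ! * p n k
    ≡⟨ distribute (k !) m (m !) n (n C k) (S m) (suc n C k) ⟩
  suc m * n * S m * ((n C k) * (k ! * m !)) + (suc n C k) * (k ! * suc m !)
    ≡⟨ cong₂ (λ a b → suc m * n * S m * a + b) (nCk*k!*[n∸k]!≡n! k≤n)
         (subst (λ r → (suc n C k) * (k ! * r !) ≡ suc n !) n+1∸k≡1+m (nCk*k!*[n∸k]!≡n! k≤n+1)) ⟩
  suc m * n * S m * n ! + suc n !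
    ≡⟨ collect m n (S m) (n !) ⟩
  n ! * (n * (suc m * S m + 1) + 1)
    ≡⟨ cong (λ s → n ! * (n * s + 1)) (trans (cong S n+1∸k≡1+m) (S-suc m)) ⟨
  n ! * (n * S (suc n ∸ k) + 1) ∎
  where
  m = n ∸ k
  n+1∸k≡1+m : suc n ∸ k ≡ suc m
  n+1∸k≡1+m = +-∸-assoc 1 k≤n
  distribute : ∀ K m M n c₁ s c₂ →
    K * (M + m * M) * (n * c₁ * s + c₂) ≡ (1 + m) * n * s * (c₁ * (K * M)) + c₂ * (K * (M + m * M))
  distribute = solve-∀
  collect : ∀ m n s f → (1 + m) * n * s * f + (f + n * f) ≡ f * (n * ((1 + m) * s + 1) + 1)
  collect = solve-∀

p-col0 : ∀ n → p n 0 ≡ n * S n + 1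
p-col0 n = cong (λ c → c * S n + 1) (*-identityʳ n)

p-col1 : ∀ n → p n 1 ≡ n * S n + 1
p-col1 zero    = refl
p-col1 (suc m) rewrite nC1≡n (suc m) | nC1≡n (suc (suc m)) | S-suc m = regroup m (S m)
  where
  regroup : ∀ m s → (1 + m) * (1 + m) * s + (2 + m) ≡ (1 + m) * ((1 + m) * s + 1) + 1
  regroup = solve-∀

sumTo-cong : ∀ N {f g : ℕ → ℤ} → (∀ l → l < N → f l ≡ g l) → sumTo N f ≡ sumTo N g
sumTo-cong zero    f≡g = refl
sumTo-cong (suc N) f≡g = cong₂ ℤ._+_ (sumTo-cong N (λ l l<N → f≡g l (m<n⇒m<1+n l<N))) (f≡g N (n<1+n N))

sumTo-0 : ∀ N → sumTo N (λ _ → + 0) ≡ + 0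
sumTo-0 zero    = refl
sumTo-0 (suc N) = cong (ℤ._+ + 0) (sumTo-0 N)

sumTo-+ : ∀ N (f g : ℕ → ℤ) → sumTo N (λ l → f l ℤ.+ g l) ≡ sumTo N f ℤ.+ sumTo N g
sumTo-+ zero    f g = refl
sumTo-+ (suc N) f g = trans (cong (ℤ._+ (f N ℤ.+ g N)) (sumTo-+ N f g))
                            (interchange (sumTo N f) (sumTo N g) (f N) (g N))
  where open CommSemigroupProperties ℤP.+-commutativeSemigroup using (interchange)

sumTo-*ˡ : ∀ N c (f : ℕ → ℤ) → c ℤ.* sumTo N f ≡ sumTo N (λ l → c ℤ.* f l)
sumTo-*ˡ zero    c f = ℤP.*-zeroʳ c
sumTo-*ˡ (suc N) c f = trans (ℤP.*-distribˡ-+ c (sumTo N f) (f N)) (cong (ℤ._+ c ℤ.* f N) (sumTo-*ˡ N c f))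

sumTo-*ʳ : ∀ N c (f : ℕ → ℤ) → sumTo N f ℤ.* c ≡ sumTo N (λ l → f l ℤ.* c)
sumTo-*ʳ N c f = begin
  sumTo N f ℤ.* c                  ≡⟨ ℤP.*-comm (sumTo N f) c ⟩
  c ℤ.* sumTo N f                  ≡⟨ sumTo-*ˡ N c f ⟩
  sumTo N (λ l → c ℤ.* f l)        ≡⟨ sumTo-cong N (λ l _ → ℤP.*-comm c (f l)) ⟩
  sumTo N (λ l → f l ℤ.* c)        ∎

sumTo-comm : ∀ N M (f : ℕ → ℕ → ℤ) →
  sumTo N (λ i → sumTo M (λ j → f i j)) ≡ sumTo M (λ j → sumTo N (λ i → f i j))
sumTo-comm zero    M f = sym (sumTo-0 M)
sumTo-comm (suc N) M f = trans (cong (ℤ._+ sumTo M (f N)) (sumTo-comm N M f))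
                               (sym (sumTo-+ M (λ j → sumTo N (λ i → f i j)) (f N)))

sumTo-extend : ∀ {a} b (g : ℕ → ℤ) → a ≤ b → (∀ j → a ≤ j → g j ≡ + 0) → sumTo b g ≡ sumTo a g
sumTo-extend {a} b g a≤b tail≡0 with m≤n⇒m<n∨m≡n a≤b
sumTo-extend     _       g a≤b tail≡0 | inj₂ refl      = refl
sumTo-extend {a} (suc b) g a≤b tail≡0 | inj₁ (s≤s a≤b′) = begin
  sumTo b g ℤ.+ g b    ≡⟨ cong₂ ℤ._+_ (sumTo-extend b g a≤b′ tail≡0) (tail≡0 b a≤b′) ⟩
  sumTo a g ℤ.+ + 0    ≡⟨ ℤP.+-identityʳ (sumTo a g) ⟩
  sumTo a g            ∎

δ-diag : ∀ a → δ a a ≡ + 1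
δ-diag zero    = refl
δ-diag (suc a) = δ-diag a

δ-offdiag : ∀ a j → a ≢ j → δ a j ≡ + 0
δ-offdiag zero    zero    a≢j = contradiction refl a≢j
δ-offdiag zero    (suc j) a≢j = refl
δ-offdiag (suc a) zero    a≢j = refl
δ-offdiag (suc a) (suc j) a≢j = δ-offdiag a j (a≢j ∘ cong suc)

sumTo-δ : ∀ N a (f : ℕ → ℤ) → a < N → sumTo N (λ j → δ a j ℤ.* f j) ≡ f a
sumTo-δ N a f a<N = begin
  sumTo N g                                ≡⟨ sumTo-extend N g a<N (λ j a<j → off (<⇒≢ a<j)) ⟩
  sumTo a g ℤ.+ δ a a ℤ.* f a              ≡⟨ cong₂ ℤ._+_ (trans (sumTo-cong a (λ j j<a → off (>⇒≢ j<a)))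
                                                                 (sumTo-0 a))
                                                          (cong (ℤ._* f a) (δ-diag a)) ⟩
  + 0 ℤ.+ + 1 ℤ.* f a                      ≡⟨ trans (ℤP.+-identityˡ _) (ℤP.*-identityˡ (f a)) ⟩
  f a                                      ∎
  where
  g : ℕ → ℤ
  g j = δ a j ℤ.* f j
  off : ∀ {j} → a ≢ j → g j ≡ + 0
  off {j} a≢j = cong (ℤ._* f j) (δ-offdiag a j a≢j)

pos-sumℕ : ∀ N (f : ℕ → ℕ) → + sumℕ N f ≡ sumTo N (λ j → + f j)
pos-sumℕ zero    f = refl
pos-sumℕ (suc N) f = trans (ℤP.pos-+ (sumℕ N f) (f N)) (cong (ℤ._+ + f N) (pos-sumℕ N f))

·ₗ-cancelˡ : ∀ (U A B : Mat) → LowerTriangular A → (∀ n k → (U ·ₗ A) n k ≡ δ n k) →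
             ∀ n k → (U ·ₗ (A ·ₗ B)) n k ≡ B n k
·ₗ-cancelˡ U A B A-lower UA≡I n k = begin
  sumTo (suc n) (λ i → U n i ℤ.* sumTo (suc i) (λ j → A i j ℤ.* B j k))
    ≡⟨ sumTo-cong (suc n) (λ i i≤n → cong (U n i ℤ.*_) (sym (sumTo-extend (suc n) _ i≤n
         (λ j i<j → cong (ℤ._* B j k) (A-lower i j i<j))))) ⟩
  sumTo (suc n) (λ i → U n i ℤ.* sumTo (suc n) (λ j → A i j ℤ.* B j k))
    ≡⟨ sumTo-cong (suc n) (λ i _ → sumTo-*ˡ (suc n) (U n i) _) ⟩
  sumTo (suc n) (λ i → sumTo (suc n) (λ j → U n i ℤ.* (A i j ℤ.* B j k)))
    ≡⟨ sumTo-comm (suc n) (suc n) _ ⟩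
  sumTo (suc n) (λ j → sumTo (suc n) (λ i → U n i ℤ.* (A i j ℤ.* B j k)))
    ≡⟨ sumTo-cong (suc n) (λ j _ → trans (sumTo-cong (suc n) (λ i _ → sym (ℤP.*-assoc (U n i) (A i j) (B j k))))
                                          (sym (sumTo-*ʳ (suc n) (B j k) (λ i → U n i ℤ.* A i j)))) ⟩
  sumTo (suc n) (λ j → (U ·ₗ A) n j ℤ.* B j k)
    ≡⟨ sumTo-cong (suc n) (λ j _ → cong (ℤ._* B j k) (UA≡I n j)) ⟩
  sumTo (suc n) (λ j → δ n j ℤ.* B j k)
    ≡⟨ sumTo-δ (suc n) n (λ j → B j k) (n<1+n n) ⟩
  B n k ∎

P : Mat
P n k = + p n k

T-lowerTriangular : LowerTriangular T
T-lowerTriangular n k n<k = cong (λ c → + (c * n ^ (n ∸ k))) (k>n⇒nCk≡0 n<k)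

ΔT≡T·P : ∀ i k → ΔT i k ≡ (T ·ₗ P) i k
ΔT≡T·P i k = begin
  ΔT i k                                   ≡⟨ sumTo-δ (suc (suc i)) (suc i) (λ j → T j k) (n<1+n (suc i)) ⟩
  + t (suc i) k                            ≡⟨ cong +_ (t-suc≡Σt*p i k) ⟩
  + sumℕ (suc i) (λ j → t i j * p j k)     ≡⟨ pos-sumℕ (suc i) _ ⟩
  sumTo (suc i) (λ j → + (t i j * p j k))  ≡⟨ sumTo-cong (suc i) (λ j _ → ℤP.pos-* (t i j) (p j k)) ⟩
  (T ·ₗ P) i k                             ∎

prod≡P : ∀ U → (∀ n k → (U ·ₗ T) n k ≡ δ n k) → ∀ n k → prod U n k ≡ P n k
prod≡P U UT≡I n k = trans (sumTo-cong (suc n) (λ i _ → cong (U n i ℤ.*_) (ΔT≡T·P i k)))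
                          (·ₗ-cancelˡ U T P T-lowerTriangular UT≡I n k)

proposition5p4 : (U : Mat) → IsInverseOfT U →
    ((n k : ℕ) → suc n < k → prod U n k ≡ + 0)
    × ((n k : ℕ) → k ≤ suc n → prod U n k ≡ + (n * (n C k) * S (n ∸ k) + (suc n C k)))
    × ((n k : ℕ) → k ≤ suc n → (+ (k ! * (suc n ∸ k) !)) ℤ.* prod U n k ≡ + (n ! * (n * S (suc n ∸ k) + 1)))
    × ((n : ℕ) → (prod U n 0 ≡ + (n * S n + 1)) × (prod U n 1 ≡ + (n * S n + 1)))
proposition5p4 U (_ , UT≡I , _) =
    (λ n k n+1<k → trans (prod≡P′ n k) (cong +_ (p-above-superdiagonal n k n+1<k)))
  , (λ n k _ → prod≡P′ n k)
  , (λ n k k≤n+1 → begin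
       + (k ! * (suc n ∸ k) !) ℤ.* prod U n k   ≡⟨ cong (+ (k ! * (suc n ∸ k) !) ℤ.*_) (prod≡P′ n k) ⟩
       + (k ! * (suc n ∸ k) !) ℤ.* P n k        ≡⟨ ℤP.pos-* (k ! * (suc n ∸ k) !) (p n k) ⟨
       + (k ! * (suc n ∸ k) ! * p n k)          ≡⟨ cong +_ (p-factorial n k k≤n+1) ⟩
       + (n ! * (n * S (suc n ∸ k) + 1))        ∎)
  , (λ n → trans (prod≡P′ n 0) (cong +_ (p-col0 n)) , trans (prod≡P′ n 1) (cong +_ (p-col1 n)))
  where
  prod≡P′ : ∀ n k → prod U n k ≡ P n k
  prod≡P′ = prod≡P U UT≡I
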